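{- For every integer $n\geq 2$, let $Q_n\subset\mathbb{R}^{n-1}$ be the $(n-1)$-dimensional lattice simplex which is the convex hull of the $n$ points $v_0=(1,1,\dots,1)$ and, for $m=1,\dots,n-1$, the point $v_m\in\mathbb{R}^{n-1}$ with coordinates $(v_m)_k=1$ for $k<m$, $(v_m)_m=-m$, and $(v_m)_k=0$ for $k>m$. Then $Q_n$ is unimodularly equivalent to its dual polytope $Q_n^\vee$.
   Context: For a polytope $\mathcal{P}\subset\mathbb{R}^d$ containing the origin in its interior, its dual polytope is $\mathcal{P}^\vee=\{y\in\mathbb{R}^d : \langle x,y\rangle\leq 1 \text{ for all } x\in\mathcal{P}\}$. Two polytopes $\mathcal{P}_1,\mathcal{P}_2\subset\mathbb{R}^d$ are unimodularly equivalent if there exist an integer matrix $U\in\mathbb{Z}^{d\times d}$ with $\det U=\pm1$ and a vector $w\in\mathbb{Z}^d$ such that $\mathcal{P}_2=\{xU : x\in\mathcal{P}_1\}+w$. Coordinates of points of $\mathbb{R}^{n-1}$ are written $(x_1,\dots,x_{n-1})$.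
   Formalization: The polytopes $Q_n$ and $Q_n^\vee$ are taken as their sets of points in ℚ^(n−1) instead of ℝ^(n−1), with the inequality defining the dual checked at rational points of $Q_n$ only. -}

module Defs where

open import Data.Nat as ℕ using (ℕ; zero; suc; _<ᵇ_; _≡ᵇ_)
open import Data.Bool using (if_then_else_)
open import Data.Fin using (Fin; zero; suc; toℕ; punchIn)
open import Data.Integer as ℤ using (ℤ; +_)
open import Data.Rational as ℚ using (ℚ; 0ℚ; 1ℚ; _/_)
open import Data.Product using (Σ; ∃; _×_; _,_)
open import Relation.Binary.PropositionalEquality using (_≡_)

-- Points of ℚ^d (rational points of ℝ^d), as functions Fin d → ℚ.
Point : ℕ → Set
Point d = Fin d → ℚ

sumℚ : ∀ {k} → (Fin k → ℚ) → ℚ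
sumℚ {zero}  f = 0ℚ
sumℚ {suc k} f = f zero ℚ.+ sumℚ (λ i → f (suc i))

sumℤ : ∀ {k} → (Fin k → ℤ) → ℤ
sumℤ {zero}  f = + 0
sumℤ {suc k} f = f zero ℤ.+ sumℤ (λ i → f (suc i))

toℚ : ℤ → ℚ
toℚ z = z / 1

⟨_,_⟩ : ∀ {d} → Point d → Point d → ℚ
⟨ x , y ⟩ = sumℚ (λ i → x i ℚ.* y i)

InConvexHull : ∀ {d k} → (Fin k → Point d) → Point d → Set
InConvexHull {d} {k} V x =
  Σ (Fin k → ℚ) λ c →
    (∀ i → 0ℚ ℚ.≤ c i) × (sumℚ c ≡ 1ℚ) ×
    (∀ j → x j ≡ sumℚ (λ i → c i ℚ.* V i j))

Dual : ∀ {d} → (Point d → Set) → Point d → Set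
Dual P y = ∀ x → P x → ⟨ x , y ⟩ ℚ.≤ 1ℚ

Matℤ : ℕ → Set
Matℤ d = Fin d → Fin d → ℤ

sign : ℕ → ℤ
sign zero = + 1
sign (suc zero) = ℤ.- (+ 1)
sign (suc (suc n)) = sign n

det : ∀ {d} → Matℤ d → ℤ
det {zero}  M = + 1
det {suc d} M =
  sumℤ (λ j → sign (toℕ j) ℤ.* (M zero j ℤ.* det (λ r c → M (suc r) (punchIn j c))))

affineImage : ∀ {d} → Matℤ d → (Fin d → ℤ) → Point d → Point d
affineImage U w x k = sumℚ (λ j → x j ℚ.* toℚ (U j k)) ℚ.+ toℚ (w k)

-- Vertices of Q_n, n = suc d.  Index zero ↦ v_0 = (1,…,1);
-- index suc m' ↦ v_m with m = toℕ m' + 1; coordinate k (0-based) is x_{toℕ k + 1}.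
-- (v_m)_{k+1} = 1 if k+1 < m, = -m if k+1 = m, = 0 if k+1 > m.
vertexℤ : ∀ {d} → Fin (suc d) → Fin d → ℤ
vertexℤ zero     k = + 1
vertexℤ (suc m') k =
  if toℕ k <ᵇ toℕ m' then + 1
  else if toℕ k ≡ᵇ toℕ m' then ℤ.- (+ (suc (toℕ m')))
  else + 0

vertex : ∀ {d} → Fin (suc d) → Point d
vertex m k = toℚ (vertexℤ m k)

Q : ∀ d → Point d → Set
Q d = InConvexHull (vertex {d})

UnimodularlyEquivalent : ∀ {d} → (Point d → Set) → (Point d → Set) → Set
UnimodularlyEquivalent {d} P₁ P₂ =
  Σ (Matℤ d) λ U → Σ (Fin d → ℤ) λ w →
    ((det U ≡ + 1) Data.Sum.⊎ (det U ≡ ℤ.- (+ 1))) ×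
    (∀ y → (P₂ y → ∃ λ x → P₁ x × (∀ k → y k ≡ affineImage U w x k))
         × ((∃ λ x → P₁ x × (∀ k → y k ≡ affineImage U w x k)) → P₂ y))
  where import Data.Sum

{-# OPTIONS --safe #-}
-- Write v₀ = (1, …, 1) and v₁, …, v_d for the other vertices (d = n - 1).
-- A direct computation gives ⟨vᵢ, vⱼ⟩ = -1 for i ≠ j and ⟨vᵢ, vᵢ⟩ ≥ 0, so every
-- point of Q satisfies the n inequalities ⟨vᵢ, x⟩ ≥ -1. Conversely, every x
-- satisfying them is a convex combination of the vertices: with
-- bₘ = (1 + x₁ + ⋯ + xₘ) / (m + 1), the coefficients c₀ = b_d and
-- cₘ = bₘ₋₁ - bₘ = (1 + ⟨vₘ, x⟩) / (m (m + 1)) are nonnegative, telescope to 1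
-- and reproduce x. Since the dual of a convex hull is cut out by the
-- inequalities ⟨vᵢ, y⟩ ≤ 1, this shows Q^∨ = -Q, and x ↦ -x is unimodular.
module Submission where

open import Defs
open import Function using (_∘_)
open import Data.Nat as ℕ using (ℕ; zero; suc; _<ᵇ_; _≡ᵇ_; z≤n; s≤s; z<s; s<s)
import Data.Nat.Properties as ℕP
open import Data.Nat.Coprimality as Coprimality using (1-coprimeTo)
open import Data.Bool using (true; false; if_then_else_)
open import Data.Fin using (Fin; zero; suc; toℕ)
open import Data.Fin.Properties using (toℕ<n; toℕ-injective) renaming (_≟_ to _≟ᶠ_)
open import Data.Integer as ℤ using (ℤ; -[1+_])
import Data.Integer.Properties as ℤP
open import Data.Rational as ℚ using (ℚ; 0ℚ; 1ℚ; mkℚ; _+_; _*_; -_; _-_; _≤_; 1/_; Positive)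
import Data.Rational.Properties as ℚP
open import Data.Rational.Solver using (module +-*-Solver)
open import Algebra.Properties.Group ℚP.+-0-group using (⁻¹-involutive)
open import Data.Product using (_,_)
open import Data.Sum using (_⊎_; inj₁; inj₂)
open import Data.Unit using (tt)
open import Relation.Nullary using (yes; no; contradiction)
open import Relation.Binary.PropositionalEquality
open import Relation.Binary.Definitions using (tri<; tri≈; tri>)
open +-*-Solver
open ≡-Reasoning

sumℚ-cong : ∀ {k} {f g : Fin k → ℚ} → (∀ i → f i ≡ g i) → sumℚ f ≡ sumℚ g
sumℚ-cong {zero}  f≗g = refl
sumℚ-cong {suc k} f≗g = cong₂ _+_ (f≗g zero) (sumℚ-cong (f≗g ∘ suc))

sumℚ-zero : ∀ k → sumℚ {k} (λ _ → 0ℚ) ≡ 0ℚ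
sumℚ-zero zero    = refl
sumℚ-zero (suc k) = cong (0ℚ +_) (sumℚ-zero k)

sumℚ-distrib-+ : ∀ {k} (f g : Fin k → ℚ) → sumℚ (λ i → f i + g i) ≡ sumℚ f + sumℚ g
sumℚ-distrib-+ {zero}  f g = refl
sumℚ-distrib-+ {suc k} f g = begin
  (f zero + g zero) + sumℚ (λ i → f (suc i) + g (suc i))
    ≡⟨ cong (f zero + g zero +_) (sumℚ-distrib-+ (f ∘ suc) (g ∘ suc)) ⟩
  (f zero + g zero) + (sumℚ (f ∘ suc) + sumℚ (g ∘ suc))
    ≡⟨ solve 4 (λ a b c d → (a :+ b) :+ (c :+ d) := (a :+ c) :+ (b :+ d)) refl
         (f zero) (g zero) (sumℚ (f ∘ suc)) (sumℚ (g ∘ suc)) ⟩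
  (f zero + sumℚ (f ∘ suc)) + (g zero + sumℚ (g ∘ suc)) ∎

sumℚ-comm : ∀ {k l} (F : Fin k → Fin l → ℚ) →
            sumℚ (λ i → sumℚ (F i)) ≡ sumℚ (λ j → sumℚ (λ i → F i j))
sumℚ-comm {zero}  {l} F = sym (sumℚ-zero l)
sumℚ-comm {suc k}     F = trans (cong (sumℚ (F zero) +_) (sumℚ-comm (F ∘ suc)))
                                (sym (sumℚ-distrib-+ (F zero) _))

*-distribˡ-sumℚ : ∀ {k} a (f : Fin k → ℚ) → a * sumℚ f ≡ sumℚ (λ i → a * f i)
*-distribˡ-sumℚ {zero}  a f = ℚP.*-zeroʳ a
*-distribˡ-sumℚ {suc k} a f = trans (ℚP.*-distribˡ-+ a (f zero) _)
                                    (cong (a * f zero +_) (*-distribˡ-sumℚ a (f ∘ suc)))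

*-distribʳ-sumℚ : ∀ {k} a (f : Fin k → ℚ) → sumℚ f * a ≡ sumℚ (λ i → f i * a)
*-distribʳ-sumℚ {zero}  a f = ℚP.*-zeroˡ a
*-distribʳ-sumℚ {suc k} a f = trans (ℚP.*-distribʳ-+ a (f zero) _)
                                    (cong (f zero * a +_) (*-distribʳ-sumℚ a (f ∘ suc)))

neg-distrib-sumℚ : ∀ {k} (f : Fin k → ℚ) → - sumℚ f ≡ sumℚ (λ i → - f i)
neg-distrib-sumℚ {zero}  f = refl
neg-distrib-sumℚ {suc k} f = trans (ℚP.neg-distrib-+ (f zero) _)
                                   (cong (- f zero +_) (neg-distrib-sumℚ (f ∘ suc)))

sumℚ-mono-≤ : ∀ {k} {f g : Fin k → ℚ} → (∀ i → f i ≤ g i) → sumℚ f ≤ sumℚ g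
sumℚ-mono-≤ {zero}  f≤g = ℚP.≤-refl
sumℚ-mono-≤ {suc k} f≤g = ℚP.+-mono-≤ (f≤g zero) (sumℚ-mono-≤ (f≤g ∘ suc))

δ : ∀ {k} → Fin k → Fin k → ℚ
δ zero    zero    = 1ℚ
δ zero    (suc _) = 0ℚ
δ (suc _) zero    = 0ℚ
δ (suc i) (suc j) = δ i j

δ-nonNeg : ∀ {k} (i j : Fin k) → 0ℚ ≤ δ i j
δ-nonNeg zero    zero    = ℚP.≤ᵇ⇒≤ tt
δ-nonNeg zero    (suc j) = ℚP.≤-refl
δ-nonNeg (suc i) zero    = ℚP.≤-refl
δ-nonNeg (suc i) (suc j) = δ-nonNeg i j

sumℚ-δ : ∀ {k} (i : Fin k) (f : Fin k → ℚ) → sumℚ (λ j → δ i j * f j) ≡ f i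
sumℚ-δ {suc k} zero f = begin
  1ℚ * f zero + sumℚ (λ j → 0ℚ * f (suc j))
    ≡⟨ cong₂ _+_ (ℚP.*-identityˡ (f zero)) (sumℚ-cong (λ j → ℚP.*-zeroˡ (f (suc j)))) ⟩
  f zero + sumℚ {k} (λ _ → 0ℚ)
    ≡⟨ cong (f zero +_) (sumℚ-zero k) ⟩
  f zero + 0ℚ
    ≡⟨ ℚP.+-identityʳ (f zero) ⟩
  f zero ∎
sumℚ-δ (suc i) f = trans (cong₂ _+_ (ℚP.*-zeroˡ (f zero)) (sumℚ-δ i (f ∘ suc)))
                         (ℚP.+-identityˡ (f (suc i)))

sumTo : ℕ → (ℕ → ℚ) → ℚ
sumTo n g = sumℚ {n} (λ i → g (toℕ i))

sumTo-cong : ∀ n {f g : ℕ → ℚ} → (∀ k → k ℕ.< n → f k ≡ g k) → sumTo n f ≡ sumTo n g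
sumTo-cong n f≗g = sumℚ-cong (λ i → f≗g (toℕ i) (toℕ<n i))

sumTo-last : ∀ n (g : ℕ → ℚ) → sumTo (suc n) g ≡ sumTo n g + g n
sumTo-last zero    g = trans (ℚP.+-identityʳ (g 0)) (sym (ℚP.+-identityˡ (g 0)))
sumTo-last (suc n) g = trans (cong (g 0 +_) (sumTo-last n (g ∘ suc)))
                             (sym (ℚP.+-assoc (g 0) _ _))

sumTo-telescope : ∀ n (a : ℕ → ℚ) → sumTo n (λ k → a k - a (suc k)) ≡ a 0 - a n
sumTo-telescope zero    a = sym (ℚP.+-inverseʳ (a 0))
sumTo-telescope (suc n) a = begin
  (a 0 - a 1) + sumTo n (λ k → a (suc k) - a (suc (suc k)))
    ≡⟨ cong ((a 0 - a 1) +_) (sumTo-telescope n (a ∘ suc)) ⟩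
  (a 0 - a 1) + (a 1 - a (suc n))
    ≡⟨ solve 3 (λ x y z → (x :- y) :+ (y :- z) := x :- z) refl (a 0) (a 1) (a (suc n)) ⟩
  a 0 - a (suc n) ∎

sumTo-stair : ∀ {m n} (w X : ℕ → ℚ) → m ℕ.< n →
              (∀ {k} → k ℕ.< m → w k ≡ 1ℚ) → (∀ {k} → m ℕ.< k → w k ≡ 0ℚ) →
              sumTo n (λ k → w k * X k) ≡ sumTo m X + w m * X m
sumTo-stair {zero} {suc n} w X _ _ above = begin
  w 0 * X 0 + sumTo n (λ k → w (suc k) * X (suc k))
    ≡⟨ cong (w 0 * X 0 +_) (trans (sumTo-cong n (λ k _ → w[1+k]*X≡0 k)) (sumℚ-zero n)) ⟩
  w 0 * X 0 + 0ℚ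
    ≡⟨ trans (ℚP.+-identityʳ (w 0 * X 0)) (sym (ℚP.+-identityˡ (w 0 * X 0))) ⟩
  0ℚ + w 0 * X 0 ∎
  where
  w[1+k]*X≡0 : ∀ k → w (suc k) * X (suc k) ≡ 0ℚ
  w[1+k]*X≡0 k = trans (cong (_* X (suc k)) (above z<s)) (ℚP.*-zeroˡ (X (suc k)))
sumTo-stair {suc m} {suc n} w X (s<s m<n) below above = begin
  w 0 * X 0 + sumTo n (λ k → w (suc k) * X (suc k))
    ≡⟨ cong₂ _+_ (trans (cong (_* X 0) (below z<s)) (ℚP.*-identityˡ (X 0)))
                 (sumTo-stair (w ∘ suc) (X ∘ suc) m<n (below ∘ s<s) (above ∘ s<s)) ⟩
  X 0 + (sumTo m (X ∘ suc) + w (suc m) * X (suc m))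
    ≡⟨ sym (ℚP.+-assoc (X 0) _ _) ⟩
  X 0 + sumTo m (X ∘ suc) + w (suc m) * X (suc m) ∎

fromℕ : ℕ → ℚ
fromℕ m = toℚ (ℤ.+ m)

-- Once fromℕ m is replaced by its normal form mkℚ (+ m) 0 _, the sum 1ℚ + fromℕ m
-- computes, up to the integer identity m * 1 = m.
fromℕ-suc : ∀ m → fromℕ (suc m) ≡ 1ℚ + fromℕ m
fromℕ-suc m = begin
  fromℕ (suc m)
    ≡⟨ cong (λ z → toℚ (ℤ.+ 1 ℤ.+ z)) (sym (ℤP.*-identityʳ (ℤ.+ m))) ⟩
  toℚ (ℤ.+ 1 ℤ.+ ℤ.+ m ℤ.* ℤ.+ 1)
    ≡⟨⟩
  1ℚ + mkℚ (ℤ.+ m) 0 m-coprime-1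
    ≡⟨ cong (1ℚ +_) (sym (ℚP.normalize-coprime m-coprime-1)) ⟩
  1ℚ + fromℕ m ∎
  where m-coprime-1 = Coprimality.sym (1-coprimeTo m)

fromℕ-nonNeg : ∀ m → 0ℚ ≤ fromℕ m
fromℕ-nonNeg m = ℚP.nonNegative⁻¹ (fromℕ m) {{ℚP.normalize-nonNeg m 1}}

fromℕ-suc-pos : ∀ m → Positive (fromℕ (suc m))
fromℕ-suc-pos m = ℚP.normalize-pos (suc m) 1

fromℕ-suc-nonZero : ∀ m → ℚ.NonZero (fromℕ (suc m))
fromℕ-suc-nonZero m = ℚP.pos⇒nonZero (fromℕ (suc m)) {{fromℕ-suc-pos m}}

1/[1+_] : ℕ → ℚ
1/[1+ m ] = (1/ fromℕ (suc m)) {{fromℕ-suc-nonZero m}}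

[1+m]*1/[1+m]≡1 : ∀ m → fromℕ (suc m) * 1/[1+ m ] ≡ 1ℚ
[1+m]*1/[1+m]≡1 m = ℚP.*-inverseʳ (fromℕ (suc m)) {{fromℕ-suc-nonZero m}}

sumTo-ones : ∀ n {g : ℕ → ℚ} → (∀ {k} → k ℕ.< n → g k ≡ 1ℚ) → sumTo n g ≡ fromℕ n
sumTo-ones zero    g≡1 = refl
sumTo-ones (suc n) g≡1 = trans (cong₂ _+_ (g≡1 z<s) (sumTo-ones n (g≡1 ∘ s<s)))
                               (sym (fromℕ-suc n))

m-[1+m]≡-1 : ∀ m → fromℕ m + (- fromℕ (suc m)) * 1ℚ ≡ - 1ℚ
m-[1+m]≡-1 m = begin
  fromℕ m + (- fromℕ (suc m)) * 1ℚ
    ≡⟨ cong (λ p → fromℕ m + (- p) * 1ℚ) (fromℕ-suc m) ⟩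
  fromℕ m + (- (1ℚ + fromℕ m)) * 1ℚ
    ≡⟨ solve 1 (λ t → t :+ (:- (con 1ℚ :+ t)) :* con 1ℚ := :- con 1ℚ) refl (fromℕ m) ⟩
  - 1ℚ ∎

-1≤0 : - 1ℚ ≤ 0ℚ
-1≤0 = ℚP.≤ᵇ⇒≤ tt

-1≤p⇒0≤1+p : ∀ {p} → - 1ℚ ≤ p → 0ℚ ≤ 1ℚ + p
-1≤p⇒0≤1+p = ℚP.+-monoʳ-≤ 1ℚ

-1≤-p⇒p≤1 : ∀ {p} → - 1ℚ ≤ - p → p ≤ 1ℚ
-1≤-p⇒p≤1 {p} -1≤-p = subst₂ _≤_ (⁻¹-involutive p) (⁻¹-involutive 1ℚ) (ℚP.neg-antimono-≤ -1≤-p)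

*-cancelˡ-0≤-pos : ∀ r {p} .{{_ : Positive r}} → 0ℚ ≤ r * p → 0ℚ ≤ p
*-cancelˡ-0≤-pos r {p} 0≤rp = ℚP.*-cancelˡ-≤-pos r (subst (_≤ r * p) (sym (ℚP.*-zeroʳ r)) 0≤rp)

⟨⟩-comm : ∀ {d} (x y : Point d) → ⟨ x , y ⟩ ≡ ⟨ y , x ⟩
⟨⟩-comm x y = sumℚ-cong (λ i → ℚP.*-comm (x i) (y i))

⟨⟩-negʳ : ∀ {d} (x y : Point d) → ⟨ x , (λ k → - y k) ⟩ ≡ - ⟨ x , y ⟩
⟨⟩-negʳ x y = trans (sumℚ-cong (λ i → sym (ℚP.neg-distribʳ-* (x i) (y i))))
                    (sym (neg-distrib-sumℚ (λ i → x i * y i)))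

⟨⟩-linearˡ : ∀ {d k} (V : Fin k → Point d) (c : Fin k → ℚ) (x y : Point d) →
             (∀ j → x j ≡ sumℚ (λ i → c i * V i j)) →
             ⟨ x , y ⟩ ≡ sumℚ (λ i → c i * ⟨ V i , y ⟩)
⟨⟩-linearˡ V c x y x≡ = begin
  sumℚ (λ j → x j * y j)
    ≡⟨ sumℚ-cong (λ j → trans (cong (_* y j) (x≡ j)) (*-distribʳ-sumℚ (y j) (λ i → c i * V i j))) ⟩
  sumℚ (λ j → sumℚ (λ i → c i * V i j * y j))
    ≡⟨ sumℚ-comm (λ j i → c i * V i j * y j) ⟩
  sumℚ (λ i → sumℚ (λ j → c i * V i j * y j))
    ≡⟨ sumℚ-cong (λ i → trans (sumℚ-cong (λ j → ℚP.*-assoc (c i) (V i j) (y j)))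
                              (sym (*-distribˡ-sumℚ (c i) (λ j → V i j * y j)))) ⟩
  sumℚ (λ i → c i * ⟨ V i , y ⟩) ∎

module _ {k} {c : Fin k → ℚ} (c≥0 : ∀ i → 0ℚ ≤ c i) (Σc≡1 : sumℚ c ≡ 1ℚ) where

  sumℚ-convex-const : ∀ a → sumℚ (λ i → c i * a) ≡ a
  sumℚ-convex-const a = trans (sym (*-distribʳ-sumℚ a c))
                              (trans (cong (_* a) Σc≡1) (ℚP.*-identityˡ a))

  sumℚ-convex-≤ : ∀ {f : Fin k → ℚ} {a} → (∀ i → f i ≤ a) → sumℚ (λ i → c i * f i) ≤ a
  sumℚ-convex-≤ {a = a} f≤a = ℚP.≤-trans
    (sumℚ-mono-≤ (λ i → ℚP.*-monoˡ-≤-nonNeg (c i) {{ℚ.nonNegative (c≥0 i)}} (f≤a i)))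
    (ℚP.≤-reflexive (sumℚ-convex-const a))

  sumℚ-convex-≥ : ∀ {f : Fin k → ℚ} {a} → (∀ i → a ≤ f i) → a ≤ sumℚ (λ i → c i * f i)
  sumℚ-convex-≥ {a = a} a≤f = ℚP.≤-trans
    (ℚP.≤-reflexive (sym (sumℚ-convex-const a)))
    (sumℚ-mono-≤ (λ i → ℚP.*-monoˡ-≤-nonNeg (c i) {{ℚ.nonNegative (c≥0 i)}} (a≤f i)))

module _ {d k} (V : Fin k → Point d) where

  vertex∈hull : ∀ i → InConvexHull V (V i)
  vertex∈hull i = δ i , δ-nonNeg i
                , trans (sumℚ-cong (λ j → sym (ℚP.*-identityʳ (δ i j)))) (sumℚ-δ i (λ _ → 1ℚ))
                , (λ j → sym (sumℚ-δ i (λ i′ → V i′ j)))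

  hull-resp-≗ : ∀ {x x′ : Point d} → (∀ j → x j ≡ x′ j) → InConvexHull V x → InConvexHull V x′
  hull-resp-≗ x≗x′ (c , c≥0 , Σc≡1 , x≡) = c , c≥0 , Σc≡1 , (λ j → trans (sym (x≗x′ j)) (x≡ j))

  hull-⟨⟩-≤ : ∀ {x y a} → InConvexHull V x → (∀ i → ⟨ V i , y ⟩ ≤ a) → ⟨ x , y ⟩ ≤ a
  hull-⟨⟩-≤ {x} {y} (c , c≥0 , Σc≡1 , x≡) Vy≤a =
    subst (_≤ _) (sym (⟨⟩-linearˡ V c x y x≡)) (sumℚ-convex-≤ c≥0 Σc≡1 Vy≤a)

  hull-⟨⟩-≥ : ∀ {x y a} → InConvexHull V x → (∀ i → a ≤ ⟨ V i , y ⟩) → a ≤ ⟨ x , y ⟩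
  hull-⟨⟩-≥ {x} {y} (c , c≥0 , Σc≡1 , x≡) a≤Vy =
    subst (_ ≤_) (sym (⟨⟩-linearˡ V c x y x≡)) (sumℚ-convex-≥ c≥0 Σc≡1 a≤Vy)

  Dual-hull : ∀ {y} → (∀ i → ⟨ V i , y ⟩ ≤ 1ℚ) → Dual (InConvexHull V) y
  Dual-hull Vy≤1 x x∈hull = hull-⟨⟩-≤ x∈hull Vy≤1

-- vertex⁺ m k is coordinate k of vertex (suc m), i.e. of v_{m+1}, with 0-based k.
vertex⁺ : ℕ → ℕ → ℚ
vertex⁺ m k = toℚ (if k <ᵇ m then ℤ.+ 1 else if k ≡ᵇ m then ℤ.- (ℤ.+ suc m) else ℤ.+ 0)

<ᵇ-true : ∀ {k m} → k ℕ.< m → (k <ᵇ m) ≡ true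
<ᵇ-true {zero}  z<s       = refl
<ᵇ-true {suc k} (s<s k<m) = <ᵇ-true k<m

<ᵇ-false : ∀ {k m} → m ℕ.≤ k → (k <ᵇ m) ≡ false
<ᵇ-false z≤n       = refl
<ᵇ-false (s≤s m≤k) = <ᵇ-false m≤k

≡ᵇ-refl : ∀ m → (m ≡ᵇ m) ≡ true
≡ᵇ-refl zero    = refl
≡ᵇ-refl (suc m) = ≡ᵇ-refl m

≡ᵇ-false : ∀ {k m} → m ℕ.< k → (k ≡ᵇ m) ≡ false
≡ᵇ-false {m = zero}  z<s       = refl
≡ᵇ-false {m = suc m} (s<s m<k) = ≡ᵇ-false m<k

vertex⁺-< : ∀ {m k} → k ℕ.< m → vertex⁺ m k ≡ 1ℚ
vertex⁺-< k<m rewrite <ᵇ-true k<m = refl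

vertex⁺-≡ : ∀ m → vertex⁺ m m ≡ - fromℕ (suc m)
vertex⁺-≡ m rewrite <ᵇ-false (ℕP.≤-refl {m}) | ≡ᵇ-refl m = refl

vertex⁺-> : ∀ {m k} → m ℕ.< k → vertex⁺ m k ≡ 0ℚ
vertex⁺-> m<k rewrite <ᵇ-false (ℕP.<⇒≤ m<k) | ≡ᵇ-false m<k = refl

vertexSeq : ∀ {d} → Fin (suc d) → ℕ → ℚ
vertexSeq zero    _ = 1ℚ
vertexSeq (suc i) k = vertex⁺ (toℕ i) k

vertex≡vertexSeq : ∀ {d} (i : Fin (suc d)) (k : Fin d) → vertex i k ≡ vertexSeq i (toℕ k)
vertex≡vertexSeq zero    k = refl
vertex≡vertexSeq (suc i) k = refl

sumTo-vertex⁺-> : ∀ {j m} → j ℕ.< m → sumTo m (vertex⁺ j) ≡ - 1ℚ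
sumTo-vertex⁺-> {j} {m} j<m = begin
  sumTo m (vertex⁺ j)
    ≡⟨ sumTo-cong m (λ k _ → sym (ℚP.*-identityʳ (vertex⁺ j k))) ⟩
  sumTo m (λ k → vertex⁺ j k * 1ℚ)
    ≡⟨ sumTo-stair (vertex⁺ j) (λ _ → 1ℚ) j<m vertex⁺-< vertex⁺-> ⟩
  sumTo j (λ _ → 1ℚ) + vertex⁺ j j * 1ℚ
    ≡⟨ cong₂ (λ s v → s + v * 1ℚ) (sumTo-ones j (λ _ → refl)) (vertex⁺-≡ j) ⟩
  fromℕ j + (- fromℕ (suc j)) * 1ℚ
    ≡⟨ m-[1+m]≡-1 j ⟩
  - 1ℚ ∎

module _ {d} {x : Point d} (X : ℕ → ℚ) (x≡X : ∀ k → x k ≡ X (toℕ k)) where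

  ⟨vertex-zero,⟩ : ⟨ vertex zero , x ⟩ ≡ sumTo d X
  ⟨vertex-zero,⟩ = sumℚ-cong (λ k → trans (ℚP.*-identityˡ (x k)) (x≡X k))

  ⟨vertex-suc,⟩ : ∀ i → let m = toℕ i in
                  ⟨ vertex (suc i) , x ⟩ ≡ sumTo m X + (- fromℕ (suc m)) * X m
  ⟨vertex-suc,⟩ i = begin
    sumℚ (λ k → vertex⁺ m (toℕ k) * x k)
      ≡⟨ sumℚ-cong (λ k → cong (vertex⁺ m (toℕ k) *_) (x≡X k)) ⟩
    sumTo d (λ k → vertex⁺ m k * X k)
      ≡⟨ sumTo-stair (vertex⁺ m) X (toℕ<n i) vertex⁺-< vertex⁺-> ⟩
    sumTo m X + vertex⁺ m m * X m
      ≡⟨ cong (λ v → sumTo m X + v * X m) (vertex⁺-≡ m) ⟩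
    sumTo m X + (- fromℕ (suc m)) * X m ∎
    where m = toℕ i

⟨vertex,vertex⟩-offDiagonal : ∀ {d} {i j : Fin (suc d)} → i ≢ j → ⟨ vertex i , vertex j ⟩ ≡ - 1ℚ
⟨vertex,vertex⟩-offDiagonal {i = zero} {zero} 0≢0 = contradiction refl 0≢0
⟨vertex,vertex⟩-offDiagonal {i = zero} {suc j} _ =
  trans (⟨vertex-zero,⟩ (vertexSeq (suc j)) (vertex≡vertexSeq (suc j))) (sumTo-vertex⁺-> (toℕ<n j))
⟨vertex,vertex⟩-offDiagonal {d} {suc i} {zero} _ = begin
  ⟨ vertex (suc i) , vertex zero ⟩
    ≡⟨ ⟨vertex-suc,⟩ (vertexSeq {d} zero) (vertex≡vertexSeq {d} zero) i ⟩
  sumTo m (λ _ → 1ℚ) + (- fromℕ (suc m)) * 1ℚ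
    ≡⟨ cong (_+ (- fromℕ (suc m)) * 1ℚ) (sumTo-ones m (λ _ → refl)) ⟩
  fromℕ m + (- fromℕ (suc m)) * 1ℚ
    ≡⟨ m-[1+m]≡-1 m ⟩
  - 1ℚ ∎
  where m = toℕ i
⟨vertex,vertex⟩-offDiagonal {i = suc i} {suc j} i≢j with ℕP.<-cmp (toℕ i) (toℕ j)
... | tri< m<j _ _ = begin
  ⟨ vertex (suc i) , vertex (suc j) ⟩
    ≡⟨ ⟨vertex-suc,⟩ (vertexSeq (suc j)) (vertex≡vertexSeq (suc j)) i ⟩
  sumTo m (vertex⁺ (toℕ j)) + (- fromℕ (suc m)) * vertex⁺ (toℕ j) m
    ≡⟨ cong₂ (λ s v → s + (- fromℕ (suc m)) * v)
             (sumTo-ones m (λ k<m → vertex⁺-< (ℕP.<-trans k<m m<j))) (vertex⁺-< m<j) ⟩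
  fromℕ m + (- fromℕ (suc m)) * 1ℚ
    ≡⟨ m-[1+m]≡-1 m ⟩
  - 1ℚ ∎
  where m = toℕ i
... | tri≈ _ m≡j _ = contradiction (cong suc (toℕ-injective m≡j)) i≢j
... | tri> _ _ j<m = begin
  ⟨ vertex (suc i) , vertex (suc j) ⟩
    ≡⟨ ⟨vertex-suc,⟩ (vertexSeq (suc j)) (vertex≡vertexSeq (suc j)) i ⟩
  sumTo m (vertex⁺ (toℕ j)) + (- fromℕ (suc m)) * vertex⁺ (toℕ j) m
    ≡⟨ cong₂ (λ s v → s + (- fromℕ (suc m)) * v) (sumTo-vertex⁺-> j<m) (vertex⁺-> j<m) ⟩
  - 1ℚ + (- fromℕ (suc m)) * 0ℚ
    ≡⟨ trans (cong (- 1ℚ +_) (ℚP.*-zeroʳ (- fromℕ (suc m)))) (ℚP.+-identityʳ (- 1ℚ)) ⟩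
  - 1ℚ ∎
  where m = toℕ i

⟨vertex,vertex⟩-diagonal : ∀ {d} (i : Fin (suc d)) → 0ℚ ≤ ⟨ vertex i , vertex i ⟩
⟨vertex,vertex⟩-diagonal {d} zero = subst (0ℚ ≤_) (sym d≡) (fromℕ-nonNeg d)
  where
  d≡ : ⟨ vertex zero , vertex {d} zero ⟩ ≡ fromℕ d
  d≡ = trans (⟨vertex-zero,⟩ (vertexSeq {d} zero) (vertex≡vertexSeq {d} zero))
             (sumTo-ones d (λ _ → refl))
⟨vertex,vertex⟩-diagonal (suc i) = subst (0ℚ ≤_) (sym m+p²≡)
  (ℚP.+-mono-≤ (fromℕ-nonNeg m) (ℚP.nonNegative⁻¹ (p * p) {{ℚP.pos⇒nonNeg (p * p) {{p²>0}}}}))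
  where
  m = toℕ i
  p = fromℕ (suc m)
  p²>0 = ℚP.pos*pos⇒pos p {{fromℕ-suc-pos m}} p {{fromℕ-suc-pos m}}
  m+p²≡ : ⟨ vertex (suc i) , vertex (suc i) ⟩ ≡ fromℕ m + p * p
  m+p²≡ = begin
    ⟨ vertex (suc i) , vertex (suc i) ⟩
      ≡⟨ ⟨vertex-suc,⟩ (vertexSeq (suc i)) (vertex≡vertexSeq (suc i)) i ⟩
    sumTo m (vertex⁺ m) + (- p) * vertex⁺ m m
      ≡⟨ cong₂ (λ s v → s + (- p) * v) (sumTo-ones m vertex⁺-<) (vertex⁺-≡ m) ⟩
    fromℕ m + (- p) * (- p)
      ≡⟨ cong (fromℕ m +_) (solve 1 (λ q → (:- q) :* (:- q) := q :* q) refl p) ⟩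
    fromℕ m + p * p ∎

vertex-gram : ∀ {d} (i j : Fin (suc d)) → - 1ℚ ≤ ⟨ vertex i , vertex j ⟩
vertex-gram i j with i ≟ᶠ j
... | yes refl = ℚP.≤-trans -1≤0 (⟨vertex,vertex⟩-diagonal i)
... | no i≢j   = ℚP.≤-reflexive (sym (⟨vertex,vertex⟩-offDiagonal i≢j))

Q⇒facets : ∀ {d} {x : Point d} → Q d x → ∀ i → - 1ℚ ≤ ⟨ vertex i , x ⟩
Q⇒facets {x = x} x∈Q i =
  subst (- 1ℚ ≤_) (⟨⟩-comm x (vertex i)) (hull-⟨⟩-≥ vertex x∈Q (λ j → vertex-gram j i))

toSeq : ∀ {d} → Point d → ℕ → ℚ
toSeq {zero}  x _       = 0ℚ
toSeq {suc d} x zero    = x zero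
toSeq {suc d} x (suc k) = toSeq (x ∘ suc) k

toSeq-toℕ : ∀ {d} (x : Point d) k → x k ≡ toSeq x (toℕ k)
toSeq-toℕ x zero    = refl
toSeq-toℕ x (suc k) = toSeq-toℕ (x ∘ suc) k

pq[β-β′]≡pβ-pX : ∀ p q β β′ X → q ≡ 1ℚ + p → q * β′ ≡ p * β + X →
                 p * q * (β - β′) ≡ p * β + (- p) * X
pq[β-β′]≡pβ-pX p _ β β′ X refl qβ′≡ = begin
  p * (1ℚ + p) * (β - β′)
    ≡⟨ solve 3 (λ p β β′ → p :* (con 1ℚ :+ p) :* (β :- β′)
                         := (con 1ℚ :+ p) :* (p :* β) :- p :* ((con 1ℚ :+ p) :* β′)) refl p β β′ ⟩
  (1ℚ + p) * (p * β) - p * ((1ℚ + p) * β′)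
    ≡⟨ cong (λ t → (1ℚ + p) * (p * β) - p * t) qβ′≡ ⟩
  (1ℚ + p) * (p * β) - p * (p * β + X)
    ≡⟨ solve 3 (λ p β X → (con 1ℚ :+ p) :* (p :* β) :- p :* (p :* β :+ X)
                        := p :* β :+ (:- p) :* X) refl p β X ⟩
  p * β + (- p) * X ∎

[β-β′][-p]≡X-β′ : ∀ p q β β′ X → q ≡ 1ℚ + p → q * β′ ≡ p * β + X →
                  (β - β′) * (- p) ≡ X - β′
[β-β′][-p]≡X-β′ p _ β β′ X refl qβ′≡ = begin
  (β - β′) * (- p)
    ≡⟨ solve 3 (λ p β β′ → (β :- β′) :* (:- p) := (con 1ℚ :+ p) :* β′ :- p :* β :- β′)
               refl p β β′ ⟩
  (1ℚ + p) * β′ - p * β - β′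
    ≡⟨ cong (λ t → t - p * β - β′) qβ′≡ ⟩
  p * β + X - p * β - β′
    ≡⟨ solve 4 (λ p β β′ X → p :* β :+ X :- p :* β :- β′ := X :- β′) refl p β β′ X ⟩
  X - β′ ∎

module Barycentric {d} (x : Point d) where

  X : ℕ → ℚ
  X = toSeq x

  level : ℕ → ℚ
  level m = (1ℚ + sumTo m X) * 1/[1+ m ]

  Δlevel : ℕ → ℚ
  Δlevel m = level m - level (suc m)

  coeff : Fin (suc d) → ℚ
  coeff zero    = level d
  coeff (suc i) = Δlevel (toℕ i)

  level-spec : ∀ m → fromℕ (suc m) * level m ≡ 1ℚ + sumTo m X
  level-spec m = begin
    p * ((1ℚ + sumTo m X) * 1/[1+ m ])
      ≡⟨ solve 3 (λ p s r → p :* (s :* r) := s :* (p :* r)) refl p (1ℚ + sumTo m X) 1/[1+ m ] ⟩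
    (1ℚ + sumTo m X) * (p * 1/[1+ m ])
      ≡⟨ cong ((1ℚ + sumTo m X) *_) ([1+m]*1/[1+m]≡1 m) ⟩
    (1ℚ + sumTo m X) * 1ℚ
      ≡⟨ ℚP.*-identityʳ (1ℚ + sumTo m X) ⟩
    1ℚ + sumTo m X ∎
    where p = fromℕ (suc m)

  level-suc : ∀ m → fromℕ (suc (suc m)) * level (suc m) ≡ fromℕ (suc m) * level m + X m
  level-suc m = begin
    fromℕ (suc (suc m)) * level (suc m)  ≡⟨ level-spec (suc m) ⟩
    1ℚ + sumTo (suc m) X                 ≡⟨ cong (1ℚ +_) (sumTo-last m X) ⟩
    1ℚ + (sumTo m X + X m)               ≡⟨ sym (ℚP.+-assoc 1ℚ (sumTo m X) (X m)) ⟩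
    1ℚ + sumTo m X + X m                 ≡⟨ cong (_+ X m) (sym (level-spec m)) ⟩
    fromℕ (suc m) * level m + X m        ∎

  coeff-suc-scaled : ∀ i → let m = toℕ i in
    fromℕ (suc m) * fromℕ (suc (suc m)) * coeff (suc i) ≡ 1ℚ + ⟨ vertex (suc i) , x ⟩
  coeff-suc-scaled i = begin
    p * fromℕ (suc (suc m)) * Δlevel m
      ≡⟨ pq[β-β′]≡pβ-pX p _ (level m) (level (suc m)) (X m) (fromℕ-suc (suc m)) (level-suc m) ⟩
    p * level m + (- p) * X m
      ≡⟨ cong (_+ (- p) * X m) (level-spec m) ⟩
    1ℚ + sumTo m X + (- p) * X m
      ≡⟨ ℚP.+-assoc 1ℚ (sumTo m X) ((- p) * X m) ⟩
    1ℚ + (sumTo m X + (- p) * X m)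
      ≡⟨ cong (1ℚ +_) (sym (⟨vertex-suc,⟩ X (toSeq-toℕ x) i)) ⟩
    1ℚ + ⟨ vertex (suc i) , x ⟩ ∎
    where
    m = toℕ i
    p = fromℕ (suc m)

  coeff-nonNeg : (∀ i → - 1ℚ ≤ ⟨ vertex i , x ⟩) → ∀ i → 0ℚ ≤ coeff i
  coeff-nonNeg facets zero = *-cancelˡ-0≤-pos (fromℕ (suc d)) {{fromℕ-suc-pos d}}
    (subst (0ℚ ≤_) (sym scaled) (-1≤p⇒0≤1+p (facets zero)))
    where
    scaled : fromℕ (suc d) * level d ≡ 1ℚ + ⟨ vertex zero , x ⟩
    scaled = trans (level-spec d) (cong (1ℚ +_) (sym (⟨vertex-zero,⟩ X (toSeq-toℕ x))))
  coeff-nonNeg facets (suc i) = *-cancelˡ-0≤-pos (p * q) {{pq>0}}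
    (subst (0ℚ ≤_) (sym (coeff-suc-scaled i)) (-1≤p⇒0≤1+p (facets (suc i))))
    where
    m = toℕ i
    p = fromℕ (suc m)
    q = fromℕ (suc (suc m))
    pq>0 = ℚP.pos*pos⇒pos p {{fromℕ-suc-pos m}} q {{fromℕ-suc-pos (suc m)}}

  coeff-sum : sumℚ coeff ≡ 1ℚ
  coeff-sum = begin
    level d + sumTo d Δlevel
      ≡⟨ cong (level d +_) (sumTo-telescope d level) ⟩
    level d + (level 0 - level d)
      ≡⟨ solve 2 (λ a b → a :+ (b :- a) := b) refl (level d) (level 0) ⟩
    level 0
      ≡⟨⟩
    1ℚ ∎

  -- tail k m - tail k d is the k-th coordinate of Σ_{m ≤ j < d} coeff (suc j) · vertex (suc j).
  tail : ℕ → ℕ → ℚ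
  tail k m = if k <ᵇ m then level m else X k

  tail-≤ : ∀ {k m} → m ℕ.≤ k → tail k m ≡ X k
  tail-≤ m≤k rewrite <ᵇ-false m≤k = refl

  tail-> : ∀ {k m} → k ℕ.< m → tail k m ≡ level m
  tail-> k<m rewrite <ᵇ-true k<m = refl

  tail-step : ∀ k m → Δlevel m * vertex⁺ m k ≡ tail k m - tail k (suc m)
  tail-step k m with ℕP.<-cmp m k
  ... | tri< m<k _ _ = begin
    Δlevel m * vertex⁺ m k     ≡⟨ cong (Δlevel m *_) (vertex⁺-> m<k) ⟩
    Δlevel m * 0ℚ              ≡⟨ ℚP.*-zeroʳ (Δlevel m) ⟩
    0ℚ                         ≡⟨ sym (ℚP.+-inverseʳ (X k)) ⟩
    X k - X k                  ≡⟨ sym (cong₂ _-_ (tail-≤ (ℕP.<⇒≤ m<k)) (tail-≤ m<k)) ⟩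
    tail k m - tail k (suc m)  ∎
  ... | tri≈ _ refl _ = begin
    Δlevel m * vertex⁺ m m     ≡⟨ cong (Δlevel m *_) (vertex⁺-≡ m) ⟩
    Δlevel m * (- fromℕ (suc m))
      ≡⟨ [β-β′][-p]≡X-β′ _ _ (level m) (level (suc m)) (X m) (fromℕ-suc (suc m)) (level-suc m) ⟩
    X m - level (suc m)        ≡⟨ sym (cong₂ _-_ (tail-≤ ℕP.≤-refl) (tail-> (ℕP.n<1+n m))) ⟩
    tail m m - tail m (suc m)  ∎
  ... | tri> _ _ k<m = begin
    Δlevel m * vertex⁺ m k     ≡⟨ cong (Δlevel m *_) (vertex⁺-< k<m) ⟩
    Δlevel m * 1ℚ              ≡⟨ ℚP.*-identityʳ (Δlevel m) ⟩
    Δlevel m                   ≡⟨ sym (cong₂ _-_ (tail-> k<m) (tail-> (ℕP.m<n⇒m<1+n k<m))) ⟩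
    tail k m - tail k (suc m)  ∎

  coeff-combination : ∀ j → x j ≡ sumℚ (λ i → coeff i * vertex i j)
  coeff-combination j = sym (begin
    level d * 1ℚ + sumTo d (λ m → Δlevel m * vertex⁺ m k)
      ≡⟨ cong (level d * 1ℚ +_) (sumTo-cong d (λ m _ → tail-step k m)) ⟩
    level d * 1ℚ + sumTo d (λ m → tail k m - tail k (suc m))
      ≡⟨ cong (level d * 1ℚ +_) (sumTo-telescope d (tail k)) ⟩
    level d * 1ℚ + (tail k 0 - tail k d)
      ≡⟨ cong (λ t → level d * 1ℚ + (t - tail k d)) (tail-≤ z≤n) ⟩
    level d * 1ℚ + (X k - tail k d)
      ≡⟨ cong (λ t → level d * 1ℚ + (X k - t)) (tail-> (toℕ<n j)) ⟩
    level d * 1ℚ + (X k - level d)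
      ≡⟨ solve 2 (λ b t → b :* con 1ℚ :+ (t :- b) := t) refl (level d) (X k) ⟩
    X k
      ≡⟨ sym (toSeq-toℕ x j) ⟩
    x j ∎)
    where k = toℕ j

facets⇒Q : ∀ {d} {x : Point d} → (∀ i → - 1ℚ ≤ ⟨ vertex i , x ⟩) → Q d x
facets⇒Q {x = x} facets = coeff , coeff-nonNeg facets , coeff-sum , coeff-combination
  where open Barycentric x

Dual-Q⇒Q-neg : ∀ {d} {y : Point d} → Dual (Q d) y → Q d (λ k → - y k)
Dual-Q⇒Q-neg {y = y} y∈Q∨ = facets⇒Q (λ i →
  subst (- 1ℚ ≤_) (sym (⟨⟩-negʳ (vertex i) y))
        (ℚP.neg-antimono-≤ (y∈Q∨ (vertex i) (vertex∈hull vertex i))))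

Q-neg⇒Dual-Q : ∀ {d} {y : Point d} → Q d (λ k → - y k) → Dual (Q d) y
Q-neg⇒Dual-Q {y = y} -y∈Q = Dual-hull vertex (λ i →
  -1≤-p⇒p≤1 (subst (- 1ℚ ≤_) (⟨⟩-negʳ (vertex i) y) (Q⇒facets -y∈Q i)))

negI : ∀ {d} → Matℤ d
negI zero    zero    = -[1+ 0 ]
negI zero    (suc _) = ℤ.+ 0
negI (suc _) zero    = ℤ.+ 0
negI (suc i) (suc j) = negI i j

sumℤ-zero : ∀ {k} {f : Fin k → ℤ} → (∀ i → f i ≡ ℤ.+ 0) → sumℤ f ≡ ℤ.+ 0
sumℤ-zero {zero}  f≡0 = refl
sumℤ-zero {suc k} f≡0 = cong₂ ℤ._+_ (f≡0 zero) (sumℤ-zero (f≡0 ∘ suc))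

det-negI-suc : ∀ d → det (negI {suc d}) ≡ ℤ.- det (negI {d})
det-negI-suc d = trans
  (cong₂ ℤ._+_ (trans (ℤP.*-identityˡ _) (ℤP.-1*i≡-i (det (negI {d}))))
               (sumℤ-zero {d} (λ j → ℤP.*-zeroʳ (sign (toℕ (suc j))))))
  (ℤP.+-identityʳ _)

det-negI : ∀ d → (det (negI {d}) ≡ ℤ.+ 1) ⊎ (det (negI {d}) ≡ ℤ.- (ℤ.+ 1))
det-negI zero = inj₁ refl
det-negI (suc d) with det-negI d
... | inj₁ det≡1  = inj₂ (trans (det-negI-suc d) (cong ℤ.-_ det≡1))
... | inj₂ det≡-1 = inj₁ (trans (det-negI-suc d) (cong ℤ.-_ det≡-1))

affineImage-negI : ∀ {d} (x : Point d) k → affineImage negI (λ _ → ℤ.+ 0) x k ≡ - x k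
affineImage-negI x k = trans (ℚP.+-identityʳ _) (x·negI-column x k)
  where
  x·negI-column : ∀ {d} (x : Point d) k → sumℚ (λ j → x j * toℚ (negI j k)) ≡ - x k
  x·negI-column {suc d} x zero = trans
    (cong₂ _+_ (solve 1 (λ t → t :* (:- con 1ℚ) := :- t) refl (x zero))
               (trans (sumℚ-cong (λ j → ℚP.*-zeroʳ (x (suc j)))) (sumℚ-zero d)))
    (ℚP.+-identityʳ (- x zero))
  x·negI-column x (suc k) = trans
    (cong₂ _+_ (ℚP.*-zeroʳ (x zero)) (x·negI-column (x ∘ suc) k))
    (ℚP.+-identityˡ (- x (suc k)))

theorem1 : (d : ℕ) → 1 ℕ.≤ d → UnimodularlyEquivalent (Q d) (Dual (Q d))
theorem1 d _ = negI , (λ _ → ℤ.+ 0) , det-negI d , λ y →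
    (λ y∈Q∨ → (λ k → - y k) , Dual-Q⇒Q-neg y∈Q∨
            , λ k → sym (trans (affineImage-negI (λ k → - y k) k) (⁻¹-involutive (y k))))
  , (λ (x , x∈Q , y≡-x) → Q-neg⇒Dual-Q (hull-resp-≗ vertex (λ k →
        sym (trans (cong -_ (trans (y≡-x k) (affineImage-negI x k))) (⁻¹-involutive (x k)))) x∈Q))
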